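{- Let $G$ be a connected graph, let $S$ be a PSD forcing set of $G$, and let $\mathcal{T}$ be a PSD forcing tree cover of $G$ arising from $S$. Then $$|S|-1+|S|\max\{\operatorname{rad}(T): T \text{ a component (tree) of } \mathcal{T}\}\ \geq\ \operatorname{rad}(G).$$
   Context: All graphs are finite and simple. PSD (positive semidefinite) color change rule: given a set $B$ of blue vertices (all other vertices white), let $W_1,\dots,W_k$ be the vertex sets of the components of $G-B$. If $u\in B$ and $w\in W_i$ is the only white neighbor of $u$ in $G[W_i\cup B]$, then $u$ can force $w$, i.e. $w$ may be turned blue. Starting from an initial blue set $S$, repeatedly applying this rule until no more changes are possible yields the derived set; $S$ is a PSD forcing set if the derived set is $V(G)$. A set of forces $\mathcal{F}$ for $S$ is a set of pairs $u\to v$ used to construct the derived set, where every vertex not in $S$ is forced by exactly one vertex. The PSD forcing tree cover is the graph $\mathcal{T}=(V(G),\{uv : u\to v\in\mathcal{F}\})$; it is a disjoint union of trees, each containing exactly one vertex of $S$ (its root). $\operatorname{rad}$ denotes the radius (minimum eccentricity) of a graph. -}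

module Defs where

open import Data.Nat using (ℕ; zero; suc; _≤_)
open import Data.Fin using (Fin)
open import Data.Fin.Subset using (Subset; _∈_; _∉_; _∪_; ⁅_⁆)
open import Data.List using (List; []; _∷_)
open import Data.List.Membership.Propositional using () renaming (_∈_ to _∈ₗ_)
open import Data.Product using (Σ; ∃; _×_; _,_)
open import Data.Sum using (_⊎_)
open import Data.Unit using (⊤)
open import Relation.Nullary using (¬_)
open import Relation.Binary.PropositionalEquality using (_≡_)

record Graph (n : ℕ) : Set₁ where
  field
    Adj     : Fin n → Fin n → Set
    sym     : ∀ {x y} → Adj x y → Adj y x
    irrefl  : ∀ {x} → ¬ Adj x x

data Walk {n : ℕ} (R : Fin n → Fin n → Set) : Fin n → Fin n → ℕ → Set where
  nil  : ∀ {x} → Walk R x x 0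
  cons : ∀ {x y z k} → R x y → Walk R y z k → Walk R x z (suc k)

Connected : ∀ {n} → Graph n → Set
Connected {n} G = (x y : Fin n) → ∃ λ k → Walk (Graph.Adj G) x y k

IsDist : ∀ {n} → (Fin n → Fin n → Set) → Fin n → Fin n → ℕ → Set
IsDist R x y d = Walk R x y d × (∀ k → Walk R x y k → d ≤ k)

-- e is the eccentricity of v in the graph (P, R) (vertex set P, adjacency R).
IsEcc : ∀ {n} → (Fin n → Fin n → Set) → (Fin n → Set) → Fin n → ℕ → Set
IsEcc {n} R P v e =
  (∀ u → P u → Σ ℕ λ d → IsDist R v u d × d ≤ e) ×
  (Σ (Fin n) λ u → P u × IsDist R v u e)

IsRad : ∀ {n} → (Fin n → Fin n → Set) → (Fin n → Set) → ℕ → Set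
IsRad {n} R P r =
  (Σ (Fin n) λ v → P v × IsEcc R P v r) ×
  (∀ v e → P v → IsEcc R P v e → r ≤ e)

-- White vertices x, y lie in the same component of G - B.
WhiteAdj : ∀ {n} → Graph n → Subset n → Fin n → Fin n → Set
WhiteAdj G B x y = x ∉ B × y ∉ B × Graph.Adj G x y

SameWhiteComp : ∀ {n} → Graph n → Subset n → Fin n → Fin n → Set
SameWhiteComp G B x y = ∃ λ k → Walk (WhiteAdj G B) x y k

PSDForce : ∀ {n} → Graph n → Subset n → Fin n → Fin n → Set
PSDForce {n} G B u w =
  u ∈ B × w ∉ B × Graph.Adj G u w ×
  ((w' : Fin n) → w' ∉ B → Graph.Adj G u w' → SameWhiteComp G B w w' → w' ≡ w)

-- A chronological list of valid PSD forces taking blue set B to blue set B'.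
-- Each forced vertex is white at the time it is forced, so every vertex
-- outside the start set is forced at most once.
data ForceChron {n : ℕ} (G : Graph n) : Subset n → List (Fin n × Fin n) → Subset n → Set where
  done : ∀ {B} → ForceChron G B [] B
  step : ∀ {B B' u w fs} → PSDForce G B u w →
         ForceChron G (B ∪ ⁅ w ⁆) fs B' →
         ForceChron G B ((u , w) ∷ fs) B'

-- Edges of the PSD forcing tree cover T determined by the set of forces F.
TreeAdj : ∀ {n} → List (Fin n × Fin n) → Fin n → Fin n → Set
TreeAdj F x y = ((x , y) ∈ₗ F) ⊎ ((y , x) ∈ₗ F)

InComp : ∀ {n} → List (Fin n × Fin n) → Fin n → Fin n → Set
InComp F v u = ∃ λ k → Walk (TreeAdj F) v u k

CompAdj : ∀ {n} → List (Fin n × Fin n) → Fin n → Fin n → Fin n → Set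
CompAdj F v x y = InComp F v x × InComp F v y × TreeAdj F x y

IsMaxTreeRad : ∀ {n} → List (Fin n × Fin n) → ℕ → Set
IsMaxTreeRad {n} F m =
  (Σ (Fin n) λ v → IsRad (CompAdj F v) (InComp F v) m) ×
  (∀ v r → IsRad (CompAdj F v) (InComp F v) r → r ≤ m)

-- Only two facts about PSD forcing matter: every force is an edge of G, and every vertex is
-- reached from a vertex of S along forces. So G is covered by the |S| trees, and each tree,
-- having radius at most m, fits in a G-ball of radius m around its centre. Starting from one
-- tree and repeatedly crossing an edge of the connected graph G into a tree not used yet, we
-- merge balls: two balls of radii α and β joined by an edge fit in a ball of radius α + β + 1.
-- After at most |S| trees every vertex is within |S|(m + 1) − 1 of one vertex, which bounds its
-- eccentricity and hence rad G. Existence of distances, eccentricities and radii is classical;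
-- this is harmless because the conclusion is a decidable inequality, so the proof runs in the
-- double-negation monad.
module Submission where

open import Defs
open import Data.Nat using (ℕ; _≤_; _+_; _*_; _∸_)
open import Data.Fin.Subset using (Subset; ⊤; ∣_∣)
open import Data.Fin using (Fin)
open import Data.List using (List)
open import Data.Product using (_×_)
open import Data.Unit using () renaming (⊤ to Unit)

open import Level using (0ℓ)
open import Data.Nat using (zero; suc; z≤n; s≤s; _<_; _≤?_)
open import Data.Nat.Properties
open import Data.Nat.Induction using (<-rec)
open import Data.Fin.Properties using (sequence)
open import Data.Fin.Subset using (_∈_; ⁅_⁆; Nonempty)
  renaming (_⊆_ to _⊆ₛ_; _∪_ to _∪ₛ_)
open import Data.Fin.Subset.Properties
  using (x∈p∪q⁻; x∈p∪q⁺; x∈⁅y⁆⇒x≡y; x∈⁅x⁆; ∣⁅x⁆∣≡1; p⊆q⇒∣p∣≤∣q∣; p⊂q⇒∣p∣<∣q∣; p⊆p∪q; ∈⊤)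
open import Data.List using ([]; _∷_; allFin)
open import Data.List.Membership.Propositional using () renaming (_∈_ to _∈ₗ_)
open import Data.List.Membership.Propositional.Properties using (∈-allFin)
open import Data.List.Relation.Unary.All using () renaming (lookup to lookupᴬ)
open import Data.List.Relation.Unary.Any using (here; there)
open import Data.List.Extrema.Nat using (argmax; f[xs]≤f[argmax])
open import Data.Product using (Σ; ∃; _,_; proj₁; proj₂)
open import Data.Sum using (_⊎_; inj₁; inj₂; [_,_]′)
open import Data.Unit using (tt)
open import Effect.Monad using (RawMonad)
open import Function using (_∘_; _$_)
open import Relation.Nullary using (¬_; yes; no; contradiction)
open import Relation.Nullary.Decidable using (¬¬-excluded-middle; decidable-stable)
open import Relation.Nullary.Negation using (¬¬-Monad)
open import Relation.Unary using (Pred; _⊆_; _∪_)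
open import Relation.Binary.PropositionalEquality using (refl; sym; trans; cong; subst)

open RawMonad (¬¬-Monad {0ℓ})

m<n*[1+o]⇒m≤n∸1+n*o : ∀ {m} n o → m < n * suc o → m ≤ n ∸ 1 + n * o
m<n*[1+o]⇒m≤n∸1+n*o (suc n) o m<n*[1+o] = ≤-pred (≤-trans m<n*[1+o] (≤-reflexive (*-suc (suc n) o)))

¬¬-finiteChoice : ∀ {n} {A : Fin n → Set} → (∀ i → ¬ ¬ A i) → ¬ ¬ (∀ i → A i)
¬¬-finiteChoice = sequence rawApplicative

¬¬-all⊎∃¬ : ∀ {n} {A : Pred (Fin n) 0ℓ} → ¬ ¬ ((∀ i → A i) ⊎ ∃ λ i → ¬ A i)
¬¬-all⊎∃¬ {A = A} = do
  yes witness ← ¬¬-excluded-middle {A = ∃ λ i → ¬ A i}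
    where no none → inj₁ <$> ¬¬-finiteChoice (λ i ¬Ai → none (i , ¬Ai))
  pure (inj₂ witness)

Least : (ℕ → Set) → Set
Least Q = Σ ℕ λ d → Q d × (∀ j → Q j → d ≤ j)

¬¬-least : (Q : ℕ → Set) → ∀ k → Q k → ¬ ¬ Least Q
¬¬-least Q = <-rec (λ k → Q k → ¬ ¬ Least Q) λ k smaller Qk → do
  yes (j , j<k , Qj) ← ¬¬-excluded-middle {A = Σ ℕ λ j → j < k × Q j}
    where no none → pure (k , Qk , λ j Qj → ≮⇒≥ λ j<k → none (j , j<k , Qj))
  smaller j<k Qj

module _ {n : ℕ} {R : Fin n → Fin n → Set} where

  _++ʷ_ : ∀ {x y z i j} → Walk R x y i → Walk R y z j → Walk R x z (i + j)
  nil      ++ʷ v = v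
  cons r w ++ʷ v = cons r (w ++ʷ v)

  reverseʷ : (∀ {x y} → R x y → R y x) → ∀ {x y k} → Walk R x y k → Walk R y x k
  reverseʷ R-sym nil = nil
  reverseʷ R-sym (cons {k = k} r w) =
    subst (Walk R _ _) (+-comm k 1) (reverseʷ R-sym w ++ʷ cons (R-sym r) nil)

  splitAtʷ : ∀ i {x z k} → i ≤ k → Walk R x z k →
             Σ (Fin n) λ p → Walk R x p i × Walk R p z (k ∸ i)
  splitAtʷ zero    _         w          = _ , nil , w
  splitAtʷ (suc i) (s≤s i≤k) (cons r w) with p , w₁ , w₂ ← splitAtʷ i i≤k w = p , cons r w₁ , w₂

  ¬¬-crossing : ∀ {A : Pred (Fin n) 0ℓ} {a b k} → Walk R a b k → A a → ¬ A b →
                ¬ ¬ Σ (Fin n) λ x → Σ (Fin n) λ y → A x × ¬ A y × R x y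
  ¬¬-crossing nil Aa ¬Ab = contradiction Aa ¬Ab
  ¬¬-crossing {A = A} (cons {y = a′} r w) Aa ¬Ab = do
    yes Aa′ ← ¬¬-excluded-middle {A = A a′}
      where no ¬Aa′ → pure (_ , a′ , Aa , ¬Aa′ , r)
    ¬¬-crossing w Aa′ ¬Ab

mapʷ : ∀ {n} {R R′ : Fin n → Fin n → Set} → (∀ {x y} → R x y → R′ x y) →
       ∀ {x y k} → Walk R x y k → Walk R′ x y k
mapʷ f nil        = nil
mapʷ f (cons r w) = cons (f r) (mapʷ f w)

Ball : ∀ {n} → (Fin n → Fin n → Set) → Fin n → ℕ → Pred (Fin n) 0ℓ
Ball R c ρ u = ∃ λ k → Walk R c u k × k < ρ

Ball-mono : ∀ {n} {R : Fin n → Fin n → Set} {c ρ ρ′} → ρ ≤ ρ′ → Ball R c ρ ⊆ Ball R c ρ′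
Ball-mono ρ≤ρ′ (k , w , k<ρ) = k , w , <-≤-trans k<ρ ρ≤ρ′

module _ {n : ℕ} {R : Fin n → Fin n → Set} (R-sym : ∀ {x y} → R x y → R y x) where

  Ball-merge : ∀ {A B : Pred (Fin n) 0ℓ} {a b α β x y} →
               A ⊆ Ball R a α → B ⊆ Ball R b β → A x → B y → R x y →
               Σ (Fin n) λ p → A ∪ B ⊆ Ball R p (α + β)
  Ball-merge {A} {B} {a} {b} {α} {β} A⊆ B⊆ Ax By xy = p , λ { (inj₁ Au) → fromA Au ; (inj₂ Bu) → fromB Bu }
    where
    k₁ = proj₁ (A⊆ Ax)
    k₂ = proj₁ (B⊆ By)
    L = k₁ + suc k₂

    spine : Walk R a b L
    spine = proj₁ (proj₂ (A⊆ Ax)) ++ʷ cons xy (reverseʷ R-sym (proj₁ (proj₂ (B⊆ By))))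

    L<α+β : L < α + β
    L<α+β = +-mono-≤ (proj₂ (proj₂ (A⊆ Ax))) (proj₂ (proj₂ (B⊆ By)))

    -- The midpoint p sits at distance L ∸ α from a along the spine.
    d = L ∸ α

    d≤β : d ≤ β
    d≤β = m≤n+o⇒m∸n≤o L α (<⇒≤ L<α+β)

    L∸d≤α : L ∸ d ≤ α
    L∸d≤α = m≤n+o⇒m∸n≤o L d (≤-trans (m≤n+m∸n L α) (≤-reflexive (+-comm α d)))

    p = proj₁ (splitAtʷ d (m∸n≤m L α) spine)
    a⇝p = proj₁ (proj₂ (splitAtʷ d (m∸n≤m L α) spine))
    p⇝b = proj₂ (proj₂ (splitAtʷ d (m∸n≤m L α) spine))

    fromA : A ⊆ Ball R p (α + β)
    fromA Au with k , a⇝u , k<α ← A⊆ Au =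
      d + k , reverseʷ R-sym a⇝p ++ʷ a⇝u , <-≤-trans (+-mono-≤-< d≤β k<α) (≤-reflexive (+-comm β α))

    fromB : B ⊆ Ball R p (α + β)
    fromB Bu with k , b⇝u , k<β ← B⊆ Bu = L ∸ d + k , p⇝b ++ʷ b⇝u , +-mono-≤-< L∸d≤α k<β

module _ {n : ℕ} (R : Fin n → Fin n → Set) (P : Pred (Fin n) 0ℓ) where

  IsEcc-< : ∀ {v e ρ} → P ⊆ Ball R v ρ → IsEcc R P v e → e < ρ
  IsEcc-< P⊆ (_ , u , Pu , _ , minimal) with k , w , k<ρ ← P⊆ Pu = ≤-<-trans (minimal k w) k<ρ

  ¬¬-ecc : ∀ {v} → P v → (∀ {u} → P u → ∃ (Walk R v u)) → ¬ ¬ Σ ℕ (IsEcc R P v)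
  ¬¬-ecc {v} Pv reach = eccentricity <$> ¬¬-finiteChoice distance
    where
    Entry : Fin n → Set
    Entry u = (P u × Least (Walk R v u)) ⊎ ¬ P u

    distance : ∀ u → ¬ ¬ Entry u
    distance u = do
      yes Pu ← ¬¬-excluded-middle {A = P u}
        where no ¬Pu → pure (inj₂ ¬Pu)
      d ← ¬¬-least (Walk R v u) (proj₁ (reach Pu)) (proj₂ (reach Pu))
      pure (inj₁ (Pu , d))

    -- Vertices outside P get the dummy value 0, which never exceeds the true eccentricity.
    value : ∀ {u} → Entry u → ℕ
    value (inj₁ (_ , d , _)) = d
    value (inj₂ _)           = 0

    eccentricity : (∀ u → Entry u) → Σ ℕ (IsEcc R P v)
    eccentricity table = value (table far) , bounded , attained
      where
      far = argmax (value ∘ table) v (allFin n)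

      farthest : ∀ u → value (table u) ≤ value (table far)
      farthest u = lookupᴬ (f[xs]≤f[argmax] v (allFin n)) (∈-allFin u)

      bounded : ∀ u → P u → Σ ℕ λ d → IsDist R v u d × d ≤ value (table far)
      bounded u Pu with table u | farthest u
      ... | inj₁ (_ , d , dist) | d≤ = d , dist , d≤
      ... | inj₂ ¬Pu            | _  = contradiction Pu ¬Pu

      attained : Σ (Fin n) λ u → P u × IsDist R v u (value (table far))
      attained with table far
      ... | inj₁ (Pfar , _ , dist) = far , Pfar , dist
      ... | inj₂ _                 = v , Pv , nil , λ _ _ → z≤n

  ¬¬-rad : ∀ {v} → P v → (∀ {x y} → P x → P y → ∃ (Walk R x y)) → ¬ ¬ Σ ℕ (IsRad R P)
  ¬¬-rad Pv connected = do
    e , ecc ← ¬¬-ecc Pv (connected Pv)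
    r , centre , minimal ← ¬¬-least (λ r → Σ (Fin n) λ c → P c × IsEcc R P c r) e (_ , Pv , ecc)
    pure (r , centre , λ c e′ Pc ecc′ → minimal e′ (c , Pc , ecc′))

TreeAdj-sym : ∀ {n} {F : List (Fin n × Fin n)} {x y} → TreeAdj F x y → TreeAdj F y x
TreeAdj-sym (inj₁ xy) = inj₂ xy
TreeAdj-sym (inj₂ yx) = inj₁ yx

TreeAdj-∷ : ∀ {n} {f} {F : List (Fin n × Fin n)} {x y} → TreeAdj F x y → TreeAdj (f ∷ F) x y
TreeAdj-∷ (inj₁ xy) = inj₁ (there xy)
TreeAdj-∷ (inj₂ yx) = inj₂ (there yx)

module _ {n : ℕ} {F : List (Fin n × Fin n)} where

  InComp-extend : ∀ {s x y} → InComp F s x → TreeAdj F x y → InComp F s y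
  InComp-extend (k , w) xy = k + 1 , w ++ʷ cons xy nil

  walk⇒CompAdj-walk : ∀ {s x y k} → InComp F s x → Walk (TreeAdj F) x y k → Walk (CompAdj F s) x y k
  walk⇒CompAdj-walk s⇝x nil         = nil
  walk⇒CompAdj-walk s⇝x (cons xy w) =
    cons (s⇝x , InComp-extend s⇝x xy , xy) (walk⇒CompAdj-walk (InComp-extend s⇝x xy) w)

  CompAdj-connected : ∀ {s x y} → InComp F s x → InComp F s y → ∃ (Walk (CompAdj F s) x y)
  CompAdj-connected s⇝x@(kx , wx) (ky , wy) =
    kx + ky , walk⇒CompAdj-walk s⇝x (reverseʷ TreeAdj-sym wx ++ʷ wy)

module _ {n : ℕ} {G : Graph n} where
  open Graph G using (Adj) renaming (sym to Adj-sym)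

  ForceChron-edge : ∀ {B F B′ u w} → ForceChron G B F B′ → (u , w) ∈ₗ F → Adj u w
  ForceChron-edge (step (_ , _ , uw , _) _) (here refl) = uw
  ForceChron-edge (step _ chron)            (there uw)  = ForceChron-edge chron uw

  ForceChron-treeAdj : ∀ {B F B′ x y} → ForceChron G B F B′ → TreeAdj F x y → Adj x y
  ForceChron-treeAdj chron (inj₁ xy) = ForceChron-edge chron xy
  ForceChron-treeAdj chron (inj₂ yx) = Adj-sym (ForceChron-edge chron yx)

  ForceChron-root : ∀ {B F B′ u} → ForceChron G B F B′ → u ∈ B′ → Σ (Fin n) λ s → s ∈ B × InComp F s u
  ForceChron-root done u∈B = _ , u∈B , 0 , nil
  ForceChron-root (step {B} {u = forcer} {w} (forcer∈B , _) chron) u∈B′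
    with s , s∈B∪w , k , s⇝u ← ForceChron-root chron u∈B′ | x∈p∪q⁻ B ⁅ w ⁆ s∈B∪w
  ... | inj₁ s∈B = s , s∈B , k , mapʷ TreeAdj-∷ s⇝u
  ... | inj₂ s∈w with refl ← x∈⁅y⁆⇒x≡y w s∈w =
    forcer , forcer∈B , suc k , cons (inj₁ (here refl)) (mapʷ TreeAdj-∷ s⇝u)

module _ {n : ℕ} (G : Graph n) (F : List (Fin n × Fin n))
         (tree⊆G : ∀ {x y} → TreeAdj F x y → Graph.Adj G x y) where

  ¬¬-treeCentre : ∀ {m} → (∀ v r → IsRad (CompAdj F v) (InComp F v) r → r ≤ m) →
                  ∀ s → ¬ ¬ Σ (Fin n) λ c → InComp F s ⊆ Ball (Graph.Adj G) c (suc m)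
  ¬¬-treeCentre rad≤m s = do
    ρ , rad@((c , _ , bounded , _) , _) ← ¬¬-rad (CompAdj F s) (InComp F s) (0 , nil) CompAdj-connected
    pure (c , λ {u} s⇝u → treeDistance⇒Ball (bounded u s⇝u) (rad≤m s ρ rad))
    where
    treeDistance⇒Ball : ∀ {c u ρ m} → Σ ℕ (λ d → IsDist (CompAdj F s) c u d × d ≤ ρ) → ρ ≤ m →
                   Ball (Graph.Adj G) c (suc m) u
    treeDistance⇒Ball (d , (w , _) , d≤ρ) ρ≤m = d , mapʷ (tree⊆G ∘ proj₂ ∘ proj₂) w , s≤s (≤-trans d≤ρ ρ≤m)

module Spanning {n : ℕ} (G : Graph n) (connected : Connected G)
                (F : List (Fin n × Fin n)) (S : Subset n) (m : ℕ)
                (root : ∀ u → Σ (Fin n) λ s → s ∈ S × InComp F s u)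
                (centre : ∀ s → Σ (Fin n) λ c → InComp F s ⊆ Ball (Graph.Adj G) c (suc m)) where
  open Graph G using (Adj) renaming (sym to Adj-sym)

  Forest : Subset n → Pred (Fin n) 0ℓ
  Forest T u = Σ (Fin n) λ s → s ∈ T × InComp F s u

  Forest-∪⁅⁆ : ∀ {T s} → Forest (T ∪ₛ ⁅ s ⁆) ⊆ InComp F s ∪ Forest T
  Forest-∪⁅⁆ {T} {s} (s′ , s′∈ , s′⇝u) with x∈p∪q⁻ T ⁅ s ⁆ s′∈
  ... | inj₁ s′∈T = inj₂ (s′ , s′∈T , s′⇝u)
  ... | inj₂ s′∈s with refl ← x∈⁅y⁆⇒x≡y s s′∈s = inj₁ s′⇝u

  record Cluster : Set where
    field
      roots      : Subset n
      roots⊆S    : roots ⊆ₛ S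
      nonempty   : Nonempty roots
      hub        : Fin n
      forest⊆ball : Forest roots ⊆ Ball Adj hub (∣ roots ∣ * suc m)
  open Cluster

  ⁅⁆⊆ : ∀ {s} → s ∈ S → ⁅ s ⁆ ⊆ₛ S
  ⁅⁆⊆ {s} s∈S s′∈s with refl ← x∈⁅y⁆⇒x≡y s s′∈s = s∈S

  Forest-⁅⁆ : ∀ {s} → Forest ⁅ s ⁆ ⊆ InComp F s
  Forest-⁅⁆ {s} (s′ , s′∈s , s′⇝u) with refl ← x∈⁅y⁆⇒x≡y s s′∈s = s′⇝u

  singleton : Fin n → Cluster
  singleton u with s , s∈S , _ ← root u = record
    { roots       = ⁅ s ⁆
    ; roots⊆S     = ⁅⁆⊆ s∈S
    ; nonempty    = s , x∈⁅x⁆ s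
    ; hub         = proj₁ (centre s)
    ; forest⊆ball = Ball-mono (≤-reflexive (sym (trans (cong (_* suc m) (∣⁅x⁆∣≡1 s)) (*-identityˡ (suc m))))) ∘ proj₂ (centre s) ∘ Forest-⁅⁆
    }

  ¬¬-grow : (C : Cluster) → ∀ {y} → ¬ Forest (roots C) y → ¬ ¬ Σ Cluster λ C′ → ∣ roots C ∣ < ∣ roots C′ ∣
  ¬¬-grow C {y} y∉T = extend <$> ¬¬-crossing (proj₂ (connected s₀ y)) (s₀ , s₀∈T , 0 , nil) y∉T
    where
    T = roots C
    s₀ = proj₁ (nonempty C)
    s₀∈T = proj₂ (nonempty C)

    extend : (Σ (Fin n) λ x → Σ (Fin n) λ y → Forest T x × ¬ Forest T y × Adj x y) →
             Σ Cluster λ C′ → ∣ T ∣ < ∣ roots C′ ∣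
    extend (x , y , x∈T , y∉T , xy) with s , s∈S , s⇝y ← root y = C′ , ∣T∣<∣T′∣
      where
      T′ = T ∪ₛ ⁅ s ⁆
      s∈T′ = x∈p∪q⁺ (inj₂ (x∈⁅x⁆ s))

      ∣T∣<∣T′∣ : ∣ T ∣ < ∣ T′ ∣
      ∣T∣<∣T′∣ = p⊂q⇒∣p∣<∣q∣ (p⊆p∪q ⁅ s ⁆ , s , s∈T′ , λ s∈T → y∉T (s , s∈T , s⇝y))

      merged = Ball-merge Adj-sym (proj₂ (centre s)) (forest⊆ball C) s⇝y x∈T (Adj-sym xy)

      C′ : Cluster
      C′ = record
        { roots       = T′
        ; roots⊆S     = λ s′∈T′ → [ roots⊆S C , ⁅⁆⊆ s∈S ]′ (x∈p∪q⁻ T ⁅ s ⁆ s′∈T′)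
        ; nonempty    = s , s∈T′
        ; hub         = proj₁ merged
        ; forest⊆ball = Ball-mono (*-monoˡ-≤ (suc m) ∣T∣<∣T′∣) ∘ proj₂ merged ∘ Forest-∪⁅⁆
        }

  ¬¬-spanning : Fin n → ∀ k → ¬ ¬ Σ Cluster λ C → k ≤ ∣ roots C ∣ ⊎ (∀ u → Forest (roots C) u)
  ¬¬-spanning u zero    = pure (singleton u , inj₁ z≤n)
  ¬¬-spanning u (suc k) = do
    C , inj₁ k≤∣T∣ ← ¬¬-spanning u k
      where C , inj₂ spanning → pure (C , inj₂ spanning)
    inj₂ (y , y∉T) ← ¬¬-all⊎∃¬
      where inj₁ spanning → pure (C , inj₂ spanning)
    C′ , ∣T∣<∣T′∣ ← ¬¬-grow C y∉T
    pure (C′ , inj₁ (≤-<-trans k≤∣T∣ ∣T∣<∣T′∣))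

  -- Each step adds a root from S, so after |S| + 1 steps the trees must span G.
  ¬¬-hub : Fin n → ¬ ¬ Σ (Fin n) λ c → (λ _ → Unit) ⊆ Ball Adj c (∣ S ∣ * suc m)
  ¬¬-hub u = do
    C , inj₂ spanning ← ¬¬-spanning u (suc ∣ S ∣)
      where C , inj₁ ∣S∣<∣T∣ → contradiction (p⊆q⇒∣p∣≤∣q∣ (roots⊆S C)) (<⇒≱ ∣S∣<∣T∣)
    pure (hub C , λ {v} _ → Ball-mono (*-monoˡ-≤ (suc m) (p⊆q⇒∣p∣≤∣q∣ (roots⊆S C))) (forest⊆ball C (spanning v)))

mainTheorem1 : ∀ {n} (G : Graph n) → Connected G →
    (S : Subset n) (F : List (Fin n × Fin n)) → ForceChron G S F ⊤ →
    (m r : ℕ) → IsMaxTreeRad F m → IsRad (Graph.Adj G) (λ _ → Unit) r →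
    r ≤ ∣ S ∣ ∸ 1 + ∣ S ∣ * m
mainTheorem1 G connected S F chron m r (_ , rad≤m) ((v , _) , minimal) =
  decidable-stable (r ≤? ∣ S ∣ ∸ 1 + ∣ S ∣ * m) $ do
    centre ← ¬¬-finiteChoice (¬¬-treeCentre G F (ForceChron-treeAdj chron) rad≤m)
    c , G⊆ball ← Spanning.¬¬-hub G connected F S m (λ u → ForceChron-root chron ∈⊤) centre v
    e , ecc ← ¬¬-ecc (Graph.Adj G) (λ _ → Unit) tt (λ u → proj₁ (G⊆ball u) , proj₁ (proj₂ (G⊆ball u)))
    pure (m<n*[1+o]⇒m≤n∸1+n*o ∣ S ∣ m (≤-<-trans (minimal c e tt ecc) (IsEcc-< (Graph.Adj G) _ G⊆ball ecc)))
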